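{- Let $M$ and $U$ be matroids on the same set $E$ with $U$ uniform. Then there is a base of $U$ that is independent in $M$, or there is a base of $M$ that is independent in $U$.
   Context: Matroids are possibly infinite (B-)matroids: a matroid on $E$ is a pair $(E,\mathcal{I})$ with $\mathcal{I}\subseteq\mathcal{P}(E)$ such that (i) $\varnothing\in\mathcal{I}$; (ii) $\mathcal{I}$ is closed under subsets; (iii) for all $I,J\in\mathcal{I}$ with $J$ $\subseteq$-maximal in $\mathcal{I}$ and $I$ not maximal, there is $e\in J\setminus I$ with $I\cup\{e\}\in\mathcal{I}$; (iv) for every $X\subseteq E$, every $I\in\mathcal{I}$ with $I\subseteq X$ extends to a $\subseteq$-maximal element of $\{J\in\mathcal{I}:J\subseteq X\}$. Maximal independent sets are bases. A matroid $(E,\mathcal{I})$ is uniform if for every $I\in\mathcal{I}$, $e\in I$ and $f\in E\setminus I$ we have $(I\setminus\{e\})\cup\{f\}\in\mathcal{I}$. -}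

module Defs where

open import Level using (0ℓ)
open import Data.Empty using (⊥)
open import Data.Unit using (⊤)
open import Data.Product using (Σ; ∃; _×_; _,_)
open import Data.Sum using (_⊎_)
open import Relation.Nullary using (¬_)
open import Relation.Binary.PropositionalEquality using (_≡_; _≢_)

Subset : Set → Set₁
Subset E = E → Set

module _ {E : Set} where

  infix 4 _⊆_
  _⊆_ : Subset E → Subset E → Set
  A ⊆ B = ∀ {x} → A x → B x

  ∅ : Subset E
  ∅ _ = ⊥

  full : Subset E
  full _ = ⊤

  insert : Subset E → E → Subset E
  insert I e x = I x ⊎ x ≡ e

  exchange : Subset E → E → E → Subset E
  exchange I e f x = (I x × x ≢ e) ⊎ x ≡ f

  MaximalIn : (Subset E → Set) → Subset E → Subset E → Set₁
  MaximalIn 𝓘 X B =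
    𝓘 B × B ⊆ X × (∀ (J : Subset E) → 𝓘 J → J ⊆ X → B ⊆ J → J ⊆ B)

  MaximalIndep : (Subset E → Set) → Subset E → Set₁
  MaximalIndep 𝓘 B = MaximalIn 𝓘 full B

-- (Possibly infinite) matroid on E, axioms (i)–(iv).
record Matroid (E : Set) : Set₁ where
  field
    Indep    : Subset E → Set
    indep-∅  : Indep ∅
    indep-⊆  : ∀ {I J : Subset E} → J ⊆ I → Indep I → Indep J
    augment  : ∀ {I J : Subset E} → Indep I → Indep J →
               MaximalIndep Indep J → ¬ MaximalIndep Indep I →
               ∃ λ e → J e × ¬ I e × Indep (insert I e)
    maximal  : ∀ (X I : Subset E) → Indep I → I ⊆ X →
               ∃ λ B → I ⊆ B × MaximalIn Indep X B

  IsBase : Subset E → Set₁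
  IsBase B = MaximalIndep Indep B

open Matroid public

IsUniform : {E : Set} → Matroid E → Set₁
IsUniform {E} M = ∀ (I : Subset E) (e f : E) →
  Indep M I → I e → ¬ I f → Indep M (exchange I e f)

-- Take a base B of M. If B is independent in U we are done. Otherwise let I be a
-- maximal U-independent subset of B; it is M-independent, and some e ∈ B lies outside I.
-- If I were not a base of U, some I ∪ {x} would be U-independent, and uniformity
-- (exchanging x for e) would make I ∪ {e} ⊆ B U-independent, contradicting maximality.
module Submission where

open import Defs
open import Level using (0ℓ)
open import Axiom.ExcludedMiddle using (ExcludedMiddle)
open import Data.Product using (∃; _×_; _,_)
open import Data.Sum using (_⊎_; inj₁; inj₂)
open import Data.Empty using (⊥-elim)
open import Data.Unit using (tt)
open import Relation.Nullary using (¬_; yes; no)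
open import Relation.Binary.PropositionalEquality using (_≡_; refl; subst)

module _ {E : Set} where

  ¬⊆⇒∃∖ : ExcludedMiddle 0ℓ → {A B : Subset E} → ¬ (A ⊆ B) → ∃ λ e → A e × ¬ B e
  ¬⊆⇒∃∖ em {A} {B} A⊈B with em {∃ λ e → A e × ¬ B e}
  ... | yes witness = witness
  ... | no none = ⊥-elim (A⊈B A⊆B)
    where
    A⊆B : A ⊆ B
    A⊆B {x} ax with em {B x}
    ... | yes bx = bx
    ... | no ¬bx = ⊥-elim (none (x , ax , ¬bx))

  maximalIn-¬insert : ∀ {𝓘 : Subset E → Set} {X I : Subset E} {e : E} →
                      MaximalIn 𝓘 X I → X e → ¬ I e → ¬ 𝓘 (insert I e)
  maximalIn-¬insert {X = X} {I} {e} (_ , I⊆X , maxI) Xe ¬Ie indIe =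
    ¬Ie (maxI (insert I e) indIe insert⊆X inj₁ (inj₂ refl))
    where
    insert⊆X : insert I e ⊆ X
    insert⊆X (inj₁ ix) = I⊆X ix
    insert⊆X (inj₂ refl) = Xe

module _ {E : Set} (M : Matroid E) where

  base-exists : ∃ λ B → IsBase M B
  base-exists with maximal M full ∅ (indep-∅ M) (λ ())
  ... | B , _ , baseB = B , baseB

  maximal-subset-exists : (X : Subset E) → ∃ λ I → MaximalIn (Indep M) X I
  maximal-subset-exists X with maximal M X ∅ (indep-∅ M) (λ ())
  ... | I , _ , maxI = I , maxI

  isBase-if-¬insert : ExcludedMiddle 0ℓ → {I : Subset E} → Indep M I →
                      (∀ x → ¬ I x → ¬ Indep M (insert I x)) → IsBase M I
  isBase-if-¬insert em {I} indI ¬insert = indI , (λ _ → tt) , maxI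
    where
    maxI : ∀ J → Indep M J → J ⊆ full → I ⊆ J → J ⊆ I
    maxI J indJ _ I⊆J {x} jx with em {I x}
    ... | yes ix = ix
    ... | no ¬ix = ⊥-elim (¬insert x ¬ix (indep-⊆ M insert⊆J indJ))
      where
      insert⊆J : insert I x ⊆ J
      insert⊆J (inj₁ iy) = I⊆J iy
      insert⊆J (inj₂ refl) = jx

  uniform-insert : ExcludedMiddle 0ℓ → IsUniform M → {I : Subset E} {e f : E} →
                   ¬ I e → ¬ I f → Indep M (insert I f) → Indep M (insert I e)
  uniform-insert em unif {I} {e} {f} ¬Ie ¬If indIf with em {e ≡ f}
  ... | yes refl = indIf
  ... | no e≢f = indep-⊆ M insert⊆exchange (unif (insert I f) f e indIf (inj₂ refl) ¬insert)
    where
    ¬insert : ¬ insert I f e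
    ¬insert (inj₁ ie) = ¬Ie ie
    ¬insert (inj₂ e≡f) = e≢f e≡f
    insert⊆exchange : insert I e ⊆ exchange (insert I f) f e
    insert⊆exchange (inj₁ ix) = inj₁ (inj₁ ix , λ x≡f → ¬If (subst I x≡f ix))
    insert⊆exchange (inj₂ x≡e) = inj₂ x≡e

corollary2p4 : ExcludedMiddle 0ℓ → {E : Set} (M U : Matroid E) → IsUniform U →
    (∃ λ B → IsBase U B × Indep M B) ⊎ (∃ λ B → IsBase M B × Indep U B)
corollary2p4 em M U unif with base-exists M
... | B , baseB@(indB , _ , _) with em {Indep U B}
... | yes indU = inj₂ (B , baseB , indU)
... | no ¬indU with maximal-subset-exists U B
... | I , maxI@(indI , I⊆B , _) = inj₁ (I , isBase-if-¬insert U em indI ¬insert , indep-⊆ M I⊆B indB)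
  where
  outside : ∃ λ e → B e × ¬ I e
  outside = ¬⊆⇒∃∖ em (λ B⊆I → ¬indU (indep-⊆ U B⊆I indI))
  ¬insert : ∀ x → ¬ I x → ¬ Indep U (insert I x)
  ¬insert x ¬Ix indIx with outside
  ... | e , Be , ¬Ie = maximalIn-¬insert maxI Be ¬Ie (uniform-insert U em unif ¬Ie ¬Ix indIx)
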